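{- Let $X,Y,Z$ be pairwise disjoint sets of Boolean variables and let $A(X,Y)$, $B(Y,Z)$ be formulas with $A\wedge B\equiv 0$. Let $W=X\cup Z$. A formula $H(Y)$ is an interpolant of the implication $A\rightarrow\overline{B}$ if and only if $A\rightarrow H$ and $\exists W[A\wedge B]\equiv H\wedge\exists W[B]$.
   Context: A formula $H(Y)$ depending only on the variables of $Y$ is an interpolant of the implication $A\rightarrow\overline{B}$ if $A\rightarrow H$ and $H\rightarrow\overline{B}$. $\exists W[\cdot]$ denotes existential quantification over $W$, and $\equiv$ logical equivalence in the free variables. -}

module Defs where

open import Data.Bool using (Bool; true; false; _∧_; _∨_; not)
open import Data.Sum using (_⊎_; inj₁; inj₂; [_,_])
open import Data.Product using (Σ; _×_; _,_)
open import Relation.Binary.PropositionalEquality using (_≡_)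

data Formula (V : Set) : Set where
  var  : V → Formula V
  tt   : Formula V
  ff   : Formula V
  neg  : Formula V → Formula V
  _∧ᶠ_ : Formula V → Formula V → Formula V
  _∨ᶠ_ : Formula V → Formula V → Formula V

eval : {V : Set} → (V → Bool) → Formula V → Bool
eval ρ (var v)  = ρ v
eval ρ tt       = true
eval ρ ff       = false
eval ρ (neg f)  = not (eval ρ f)
eval ρ (f ∧ᶠ g) = eval ρ f ∧ eval ρ g
eval ρ (f ∨ᶠ g) = eval ρ f ∨ eval ρ g

-- Pairwise disjoint variable sets X, Y, Z are modelled as separate types;
-- A(X,Y) is a formula over X ⊎ Y, B(Y,Z) over Y ⊎ Z, H(Y) over Y.
module _ {X Y Z : Set} where

  evalA : Formula (X ⊎ Y) → (X → Bool) → (Y → Bool) → Bool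
  evalA A ax ay = eval [ ax , ay ] A

  evalB : Formula (Y ⊎ Z) → (Y → Bool) → (Z → Bool) → Bool
  evalB B ay az = eval [ ay , az ] B

  Disjoint : Formula (X ⊎ Y) → Formula (Y ⊎ Z) → Set
  Disjoint A B = ∀ ax ay az → (evalA A ax ay ∧ evalB B ay az) ≡ false

  AImplies : Formula (X ⊎ Y) → Formula Y → Set
  AImplies A H = ∀ ax ay → evalA A ax ay ≡ true → eval ay H ≡ true

  ImpliesNotB : Formula Y → Formula (Y ⊎ Z) → Set
  ImpliesNotB H B = ∀ ay az → eval ay H ≡ true → evalB B ay az ≡ false

  Interpolant : Formula (X ⊎ Y) → Formula (Y ⊎ Z) → Formula Y → Set
  Interpolant A B H = AImplies A H × ImpliesNotB H B

  ExW-A∧B : Formula (X ⊎ Y) → Formula (Y ⊎ Z) → (Y → Bool) → Set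
  ExW-A∧B A B ay = Σ (X → Bool) λ ax → Σ (Z → Bool) λ az →
                     (evalA A ax ay ∧ evalB B ay az) ≡ true

  ExW-B : Formula (Y ⊎ Z) → (Y → Bool) → Set
  ExW-B B ay = Σ (X → Bool) λ ax → Σ (Z → Bool) λ az → evalB B ay az ≡ true

  ExEquiv : Formula (X ⊎ Y) → Formula (Y ⊎ Z) → Formula Y → Set
  ExEquiv A B H = ∀ ay → (ExW-A∧B A B ay → (eval ay H ≡ true × ExW-B B ay))
                        × ((eval ay H ≡ true × ExW-B B ay) → ExW-A∧B A B ay)

-- Since A ∧ B ≡ 0, the left-hand side ∃W[A ∧ B] is identically false, so the
-- equation ∃W[A ∧ B] ≡ H ∧ ∃W[B] says that H ∧ ∃W[B] ≡ 0.  As B does not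
-- mention X, that is exactly the validity of H → ¬B.
module Submission where

open import Defs
open import Data.Bool using (Bool; true; false)
open import Data.Bool.Properties using (¬-not)
open import Data.Empty using (⊥-elim)
open import Data.Product using (_×_; _,_; proj₂)
open import Data.Product.Function.NonDependent.Propositional using (_×-⇔_)
open import Data.Sum using (_⊎_)
open import Function.Bundles using (_⇔_; mk⇔)
import Function.Properties.Equivalence as ⇔
open import Relation.Binary.PropositionalEquality using (_≡_; _≢_; trans; sym)
open import Relation.Nullary using (¬_)

false≢true : false ≢ true
false≢true ()

module _ {X Y Z : Set} (A : Formula (X ⊎ Y)) (B : Formula (Y ⊎ Z)) where

  ExW-H∧B : Formula Y → (Y → Bool) → Set
  ExW-H∧B H ay = eval ay H ≡ true × ExW-B {X} B ay

  ¬ExW-A∧B : Disjoint A B → ∀ ay → ¬ ExW-A∧B A B ay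
  ¬ExW-A∧B disjoint ay (ax , az , AB) = false≢true (trans (sym (disjoint ax ay az)) AB)

  ExEquiv⇔¬ExW-H∧B : Disjoint A B → (H : Formula Y) →
                      ExEquiv A B H ⇔ (∀ ay → ¬ ExW-H∧B H ay)
  ExEquiv⇔¬ExW-H∧B disjoint H = mk⇔
    (λ equiv ay HB → ¬ExW-A∧B disjoint ay (proj₂ (equiv ay) HB))
    (λ ¬HB ay → (λ AB → ⊥-elim (¬ExW-A∧B disjoint ay AB)) , (λ HB → ⊥-elim (¬HB ay HB)))

  -- The X-part of a witness of ∃W[B] is irrelevant; any assignment to X will do.
  ImpliesNotB⇔¬ExW-H∧B : (H : Formula Y) →
                          ImpliesNotB {X} H B ⇔ (∀ ay → ¬ ExW-H∧B H ay)
  ImpliesNotB⇔¬ExW-H∧B H = mk⇔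
    (λ H⇒¬B ay (Hy , _ , az , By) → false≢true (trans (sym (H⇒¬B ay az Hy)) By))
    (λ ¬HB ay az Hy → ¬-not (λ By → ¬HB ay (Hy , (λ _ → false) , az , By)))

proposition8 : {X Y Z : Set} (A : Formula (X ⊎ Y)) (B : Formula (Y ⊎ Z)) →
                 Disjoint {X} {Y} {Z} A B → (H : Formula Y) →
                 Interpolant {X} {Y} {Z} A B H ⇔ (AImplies {X} {Y} {Z} A H × ExEquiv {X} {Y} {Z} A B H)
proposition8 A B disjoint H =
  ⇔.refl ×-⇔ ⇔.trans (ImpliesNotB⇔¬ExW-H∧B A B H) (⇔.sym (ExEquiv⇔¬ExW-H∧B A B disjoint H))
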